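{- Let $\mathcal{P}$ be the set of points of $\mathrm{PG}(N,q)$ and let $\mathcal{H}=\{T\subseteq\mathcal{P}\mid \exists$ subspaces $H,H'$ with $\dim H=N-1$, $\dim H'=N-2$, $H'\subset H$, $T=H\setminus H'\}$. Then a point set $S\subseteq\mathcal{P}$ is a cutting blocking set of $\mathrm{PG}(N,q)$ if and only if $S\cap T\neq\emptyset$ for all $T\in\mathcal{H}$.
   Context: $\mathrm{PG}(N,q)$ is the $N$-dimensional projective space over $\mathbb{F}_q$. A cutting blocking set of $\mathrm{PG}(N,q)$ is a point set $S$ such that for every hyperplane $H$, the set $S\cap H$ spans $H$. -}

module Defs where

open import Level using (Level; _⊔_)
open import Data.Nat using (ℕ; zero; suc)
open import Data.Fin using (Fin; zero; suc)
open import Data.Product using (Σ; ∃; _×_; _,_)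
open import Relation.Nullary using (¬_)
open import Relation.Binary.PropositionalEquality as ≡ using (_≡_)
open import Function.Bundles using (Inverse)
open import Algebra.Bundles using (CommutativeRing)

record Field (c ℓ : Level) : Set (Level.suc (c ⊔ ℓ)) where
  field
    commutativeRing : CommutativeRing c ℓ
  open CommutativeRing commutativeRing public
  field
    0≉1     : ¬ (0# ≈ 1#)
    inverse : ∀ x → ¬ (x ≈ 0#) → ∃ λ y → x * y ≈ 1#

record FiniteField (c ℓ : Level) (q : ℕ) : Set (Level.suc (c ⊔ ℓ)) where
  field
    field′ : Field c ℓ
  open Field field′ public
  field
    enumeration : Inverse setoid (≡.setoid (Fin q))

-- Linear algebra in the vector space F^(N+1) underlying PG(N,q).
module Projective {c ℓ : Level} (F : Field c ℓ) (N : ℕ) where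
  open Field F using (Carrier; _≈_; _+_; _*_; 0#; 1#)

  V : Set c
  V = Fin (suc N) → Carrier

  _≈ᵥ_ : V → V → Set ℓ
  u ≈ᵥ v = ∀ i → u i ≈ v i

  0ᵥ : V
  0ᵥ _ = 0#

  _+ᵥ_ : V → V → V
  (u +ᵥ v) i = u i + v i

  _·_ : Carrier → V → V
  (a · v) i = a * v i

  lincomb : ∀ {m} → (Fin m → Carrier) → (Fin m → V) → V
  lincomb {zero}  c v = 0ᵥ
  lincomb {suc m} c v = (c zero · v zero) +ᵥ lincomb (λ j → c (suc j)) (λ j → v (suc j))

  Nonzero : V → Set ℓ
  Nonzero v = ¬ (v ≈ᵥ 0ᵥ)

  LinIndep : ∀ {k} → (Fin k → V) → Set (c ⊔ ℓ)
  LinIndep b = ∀ a → lincomb a b ≈ᵥ 0ᵥ → ∀ j → a j ≈ 0#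

  record Subspace (k : ℕ) : Set (c ⊔ ℓ) where
    field
      basis : Fin k → V
      indep : LinIndep basis

  _∈ₛ_ : ∀ {k} → V → Subspace k → Set (c ⊔ ℓ)
  v ∈ₛ W = ∃ λ a → v ≈ᵥ lincomb a (Subspace.basis W)

  _⊆ₛ_ : ∀ {k k′} → Subspace k → Subspace k′ → Set (c ⊔ ℓ)
  W ⊆ₛ W′ = ∀ v → v ∈ₛ W → v ∈ₛ W′

  -- A point of PG(N,q) is a 1-dimensional subspace, represented by any nonzero
  -- vector spanning it.  A point set of PG(N,q) is a predicate on vectors that
  -- holds only for nonzero vectors and is invariant under ≈ and under nonzero
  -- scalar multiplication (so it is a union of 1-dim subspaces minus 0).
  record IsPointSet {s} (S : V → Set s) : Set (c ⊔ ℓ ⊔ s) where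
    field
      nonzero : ∀ v → S v → Nonzero v
      resp-≈  : ∀ u v → u ≈ᵥ v → S u → S v
      scale   : ∀ a v → ¬ (a ≈ 0#) → S v → S (a · v)

  -- Hyperplane of PG(N,q): projective dimension N-1, i.e. vector dimension N.
  Hyperplane : Set (c ⊔ ℓ)
  Hyperplane = Subspace N

  SpansSubspace : ∀ {s k} → (S : V → Set s) → Subspace k → Set (c ⊔ ℓ ⊔ s)
  SpansSubspace S W =
    ∀ v → v ∈ₛ W →
      Σ ℕ λ m → Σ (Fin m → V) λ u →
        (∀ j → S (u j) × (u j ∈ₛ W)) × (∃ λ a → v ≈ᵥ lincomb a u)

  IsCuttingBlockingSet : ∀ {s} → (V → Set s) → Set (c ⊔ ℓ ⊔ s)
  IsCuttingBlockingSet S = ∀ (H : Hyperplane) → SpansSubspace S (H)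

  -- S meets T = H \ H' for all subspaces H ⊇ H' of projective dimensions
  -- N-1 and N-2 (vector dimensions N and n' with n' + 1 = N).
  MeetsAllH : ∀ {s} → (V → Set s) → Set (c ⊔ ℓ ⊔ s)
  MeetsAllH S =
    ∀ (H : Subspace N) (n′ : ℕ) → suc n′ ≡ N → (H′ : Subspace n′) → H′ ⊆ₛ H →
      ∃ λ v → S v × (v ∈ₛ H) × ¬ (v ∈ₛ H′)

{-# OPTIONS --safe #-}
module Submission where

-- If S ∩ H spans H, then for any hyperplane H′ of H some vector of a spanning
-- family taken from S ∩ H lies outside H′, so S meets H ∖ H′.  Conversely, if S
-- meets every H ∖ H′, grow an independent family inside S ∩ H: while it has
-- fewer than N members it lies in some hyperplane H′ of H (complete it to a
-- basis of H by basis vectors of H and drop one new vector), and a point of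
-- S ∩ (H ∖ H′) enlarges it.  After N steps it is a basis of H.  Over F_q,
-- membership in a span is decidable (there are finitely many coefficient
-- vectors), and t independent vectors in the span of m vectors give an
-- injection of the q^t coefficient vectors into the q^m ones, so t ≤ m.

open import Defs
open import Level using (Level; _⊔_)
open import Data.Nat as ℕ using (ℕ; zero; suc; _<_; _≤_; _^_)
import Data.Nat.Properties as ℕ
open import Data.Fin as Fin using (Fin; zero; suc; funToFin; finToFun)
import Data.Fin.Properties as Fin
open import Data.Vec.Functional using (_∷_; tail)
open import Data.Product using (Σ; ∃; _×_; _,_; proj₁; proj₂)
open import Data.Empty using (⊥-elim)
open import Function using (_∘_)
open import Function.Bundles using (Inverse; Injection)
open import Function.Properties.Inverse using (Inverse⇒Injection)
open import Relation.Nullary using (¬_; Dec; yes; no)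
open import Relation.Nullary.Decidable using (map′)
open import Relation.Binary.PropositionalEquality as ≡ using (_≡_; _≢_)
import Relation.Binary.Reasoning.Setoid as SetoidReasoning

funToFin-cong : ∀ {m n} {f g : Fin m → Fin n} → (∀ j → f j ≡ g j) → funToFin f ≡ funToFin g
funToFin-cong {zero}  _   = ≡.refl
funToFin-cong {suc m} f≗g = ≡.cong₂ Fin.combine (f≗g zero) (funToFin-cong (f≗g ∘ suc))

distinct⇒1<n : ∀ {n} {x y : Fin n} → x ≢ y → 1 < n
distinct⇒1<n {suc zero}    {zero} {zero} x≢y = ⊥-elim (x≢y ≡.refl)
distinct⇒1<n {suc (suc n)} _                 = ℕ.s≤s (ℕ.s≤s ℕ.z≤n)

module Span {c ℓ} (F : Field c ℓ) (N : ℕ) where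
  open Field F hiding (zero)
  open Projective F N
  open import Algebra.Properties.Ring ring using (-‿distribˡ-*)
  open import Algebra.Properties.AbelianGroup +-abelianGroup using (⁻¹-∙-comm)
  open import Algebra.Properties.Group +-group using (x∙y⁻¹≈ε⇒x≈y; ε⁻¹≈ε)
  open import Algebra.Properties.CommutativeSemigroup +-commutativeSemigroup using (interchange)

  lincomb-cong : ∀ {m} {a b : Fin m → Carrier} (u : Fin m → V) →
                 (∀ j → a j ≈ b j) → lincomb a u ≈ᵥ lincomb b u
  lincomb-cong {zero}  u a≈b i = refl
  lincomb-cong {suc m} u a≈b i = +-cong (*-cong (a≈b zero) refl) (lincomb-cong (tail u) (a≈b ∘ suc) i)

  lincomb-+ : ∀ {m} (a b : Fin m → Carrier) (u : Fin m → V) →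
              lincomb (λ j → a j + b j) u ≈ᵥ (lincomb a u +ᵥ lincomb b u)
  lincomb-+ {zero}  a b u i = sym (+-identityˡ 0#)
  lincomb-+ {suc m} a b u i =
    trans (+-cong (distribʳ (u zero i) (a zero) (b zero)) (lincomb-+ (a ∘ suc) (b ∘ suc) (tail u) i))
          (interchange _ _ _ _)

  lincomb-· : ∀ {m} k (a : Fin m → Carrier) (u : Fin m → V) →
              lincomb (λ j → k * a j) u ≈ᵥ (k · lincomb a u)
  lincomb-· {zero}  k a u i = sym (zeroʳ k)
  lincomb-· {suc m} k a u i =
    trans (+-cong (*-assoc k (a zero) (u zero i)) (lincomb-· k (a ∘ suc) (tail u) i))
          (sym (distribˡ k _ _))

  lincomb-neg : ∀ {m} (a : Fin m → Carrier) (u : Fin m → V) →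
                lincomb (λ j → - a j) u ≈ᵥ (λ i → - lincomb a u i)
  lincomb-neg {zero}  a u i = sym ε⁻¹≈ε
  lincomb-neg {suc m} a u i =
    trans (+-cong (sym (-‿distribˡ-* (a zero) (u zero i))) (lincomb-neg (a ∘ suc) (tail u) i))
          (⁻¹-∙-comm _ _)

  lincomb-0 : ∀ {m} (u : Fin m → V) → lincomb (λ _ → 0#) u ≈ᵥ 0ᵥ
  lincomb-0 {zero}  u i = refl
  lincomb-0 {suc m} u i = trans (+-cong (zeroˡ _) (lincomb-0 (tail u) i)) (+-identityˡ 0#)

  _∈span_ : ∀ {m} → V → (Fin m → V) → Set (c ⊔ ℓ)
  v ∈span u = ∃ λ a → v ≈ᵥ lincomb a u

  _⊆span_ : ∀ {k m} → (Fin k → V) → (Fin m → V) → Set (c ⊔ ℓ)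
  e ⊆span w = ∀ i → e i ∈span w

  ∈span-resp : ∀ {m} {v w : V} {u : Fin m → V} → v ≈ᵥ w → v ∈span u → w ∈span u
  ∈span-resp v≈w (a , v≈au) = a , λ i → trans (sym (v≈w i)) (v≈au i)

  ∈span-+ : ∀ {m} {v w : V} {u : Fin m → V} → v ∈span u → w ∈span u → (v +ᵥ w) ∈span u
  ∈span-+ {u = u} (a , v≈au) (b , w≈bu) =
    (λ j → a j + b j) , λ i → trans (+-cong (v≈au i) (w≈bu i)) (sym (lincomb-+ a b u i))

  ∈span-· : ∀ {m} k {v : V} {u : Fin m → V} → v ∈span u → (k · v) ∈span u
  ∈span-· k {u = u} (a , v≈au) =
    (λ j → k * a j) , λ i → trans (*-cong refl (v≈au i)) (sym (lincomb-· k a u i))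

  0ᵥ∈span : ∀ {m} {u : Fin m → V} → 0ᵥ ∈span u
  0ᵥ∈span {u = u} = (λ _ → 0#) , λ i → sym (lincomb-0 u i)

  lincomb∈span : ∀ {t m} {e : Fin t → V} {w : Fin m → V} → e ⊆span w → ∀ a → lincomb a e ∈span w
  lincomb∈span {zero}  e⊆w a = 0ᵥ∈span
  lincomb∈span {suc t} e⊆w a = ∈span-+ (∈span-· (a zero) (e⊆w zero)) (lincomb∈span (e⊆w ∘ suc) (a ∘ suc))

  ∈span-trans : ∀ {t m} {e : Fin t → V} {w : Fin m → V} {v : V} → e ⊆span w → v ∈span e → v ∈span w
  ∈span-trans e⊆w (a , v≈ae) = ∈span-resp (λ i → sym (v≈ae i)) (lincomb∈span e⊆w a)

  ∈span-tail : ∀ {m} (u : Fin (suc m) → V) {v : V} → v ∈span tail u → v ∈span u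
  ∈span-tail u (a , v≈au) = (0# ∷ a) , λ i → trans (v≈au i) (sym (trans (+-cong (zeroˡ _) refl) (+-identityˡ _)))

  ∈span-member : ∀ {m} (u : Fin m → V) → u ⊆span u
  ∈span-member u zero    = (1# ∷ λ _ → 0#) , λ i →
    sym (trans (+-cong (*-identityˡ _) (lincomb-0 (tail u) i)) (+-identityʳ _))
  ∈span-member u (suc j) = ∈span-tail u (∈span-member (tail u) j)

  independent⇒coefficients-≈ : ∀ {m} {e : Fin m → V} → LinIndep e →
                               ∀ a b → lincomb a e ≈ᵥ lincomb b e → ∀ j → a j ≈ b j
  independent⇒coefficients-≈ {e = e} e-indep a b ae≈be j =
    x∙y⁻¹≈ε⇒x≈y (a j) (b j) (e-indep (λ j → a j + - b j) ae-be≈0 j)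
    where
    ae-be≈0 : lincomb (λ j → a j + - b j) e ≈ᵥ 0ᵥ
    ae-be≈0 i = trans (lincomb-+ a (λ j → - b j) e i)
                      (trans (+-cong (ae≈be i) (lincomb-neg b e i)) (-‿inverseʳ _))

  independent-tail : ∀ {m} {e : Fin (suc m) → V} → LinIndep e → LinIndep (tail e)
  independent-tail e-indep a ae≈0 j =
    e-indep (0# ∷ a) (λ i → trans (+-cong (zeroˡ _) refl) (trans (+-identityˡ _) (ae≈0 i))) (suc j)

module FiniteSpan {c ℓ} {q} (F : FiniteField c ℓ q) (N : ℕ) where
  open FiniteField F hiding (zero)
  open Projective field′ N
  open Span field′ N
  open Inverse enumeration using (to; from; to-cong; from-cong; strictlyInverseˡ; strictlyInverseʳ)
  open Injection (Inverse⇒Injection enumeration) using () renaming (injective to to-injective)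
  open import Algebra.Properties.Ring ring using (-‿distribˡ-*; -‿distribʳ-*)
  open import Algebra.Properties.Group +-group using (inverseˡ-unique)
  open SetoidReasoning setoid

  _≈?_ : (x y : Carrier) → Dec (x ≈ y)
  x ≈? y = map′ to-injective to-cong (to x Fin.≟ to y)

  1<q : 1 < q
  1<q = distinct⇒1<n (0≉1 ∘ to-injective)

  coefficients : ∀ {m} → Fin (q ^ m) → Fin m → Carrier
  coefficients k j = from (finToFun k j)

  encode : ∀ {m} → (Fin m → Carrier) → Fin (q ^ m)
  encode a = funToFin (to ∘ a)

  coefficients-encode : ∀ {m} (a : Fin m → Carrier) j → coefficients (encode a) j ≈ a j
  coefficients-encode a j = trans (from-cong (Fin.finToFun-funToFin (to ∘ a) j)) (strictlyInverseʳ (a j))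

  encode-injective : ∀ {m} {a b : Fin m → Carrier} → encode a ≡ encode b → ∀ j → a j ≈ b j
  encode-injective {a = a} {b} ea≡eb j = begin
    a j                       ≈⟨ coefficients-encode a j ⟨
    coefficients (encode a) j ≡⟨ ≡.cong (λ k → coefficients k j) ea≡eb ⟩
    coefficients (encode b) j ≈⟨ coefficients-encode b j ⟩
    b j                       ∎

  coefficients-injective : ∀ {m} {k k′ : Fin (q ^ m)} →
                           (∀ j → coefficients {m} k j ≈ coefficients k′ j) → k ≡ k′
  coefficients-injective {m} {k} {k′} ck≈ck′ =
    ≡.trans (≡.sym (Fin.funToFin-finToFin {m} {q} k))
            (≡.trans (funToFin-cong from-injective) (Fin.funToFin-finToFin {m} {q} k′))
    where
    from-injective : ∀ (j : Fin m) → finToFun k j ≡ finToFun k′ j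
    from-injective j = ≡.trans (≡.sym (strictlyInverseˡ _)) (≡.trans (to-cong (ck≈ck′ j)) (strictlyInverseˡ _))

  _∈span?_ : ∀ {m} (v : V) (u : Fin m → V) → Dec (v ∈span u)
  v ∈span? u = map′ (λ (k , v≈ku) → coefficients k , v≈ku) encode-witness
    (Fin.any? λ k → Fin.all? λ i → v i ≈? lincomb (coefficients k) u i)
    where
    encode-witness : v ∈span u → ∃ λ k → v ≈ᵥ lincomb (coefficients k) u
    encode-witness (a , v≈au) =
      encode a , λ i → trans (v≈au i) (lincomb-cong u (λ j → sym (coefficients-encode a j)) i)

  ¬⊆span⇒∃∉span : ∀ {k m} {u : Fin k → V} {w : Fin m → V} → ¬ (u ⊆span w) → ∃ λ i → ¬ (u i ∈span w)
  ¬⊆span⇒∃∉span {k} {u = u} {w} = Fin.¬∀⟶∃¬ k _ (λ i → u i ∈span? w)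

  independent⊆span⇒≤ : ∀ {t m} {e : Fin t → V} {w : Fin m → V} → LinIndep e → e ⊆span w → t ≤ m
  independent⊆span⇒≤ {t} {m} {e} {w} e-indep e⊆w =
    ℕ.≮⇒≥ (λ m<t → ℕ.<⇒≱ (ℕ.^-monoʳ-< q 1<q m<t) (Fin.injective⇒≤ recode-injective))
    where
    recode : Fin (q ^ t) → Fin (q ^ m)
    recode k = encode (proj₁ (lincomb∈span e⊆w (coefficients k)))

    recode-injective : ∀ {k k′} → recode k ≡ recode k′ → k ≡ k′
    recode-injective {k} {k′} eq = coefficients-injective {t}
      (independent⇒coefficients-≈ e-indep (coefficients k) (coefficients k′) λ i → begin
        lincomb (coefficients k) e i   ≈⟨ proj₂ (lincomb∈span e⊆w (coefficients k)) i ⟩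
        lincomb _ w i                  ≈⟨ lincomb-cong w (encode-injective eq) i ⟩
        lincomb _ w i                  ≈⟨ proj₂ (lincomb∈span e⊆w (coefficients k′)) i ⟨
        lincomb (coefficients k′) e i  ∎)

  -- Stated here rather than in Span because the case split needs decidable equality in F.
  independent-∷ : ∀ {k} {u : Fin k → V} {v : V} → LinIndep u → ¬ (v ∈span u) → LinIndep (v ∷ u)
  independent-∷ {u = u} {v} u-indep v∉u a a·vu≈0 with a zero ≈? 0#
  ... | yes a₀≈0 = λ { zero    → a₀≈0
                     ; (suc j) → u-indep (tail a) (λ i → trans (sym (a₀v+au≈au i)) (a·vu≈0 i)) j }
    where
    a₀v+au≈au : ∀ i → a zero * v i + lincomb (tail a) u i ≈ lincomb (tail a) u i
    a₀v+au≈au i = trans (+-cong (trans (*-cong a₀≈0 refl) (zeroˡ _)) refl) (+-identityˡ _)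
  ... | no a₀≉0 = ⊥-elim (v∉u (v∈u (inverse (a zero) a₀≉0)))
    where
    L : V
    L = lincomb (tail a) u

    v∈u : ∃ (λ d → a zero * d ≈ 1#) → v ∈span u
    v∈u (d , a₀d≈1) = ∈span-resp (λ i → sym (v≈ i)) (∈span-· (- d) (lincomb∈span (∈span-member u) (tail a)))
      where
      v≈ : ∀ i → v i ≈ - d * L i
      v≈ i = begin
        v i                  ≈⟨ *-identityˡ _ ⟨
        1# * v i             ≈⟨ *-cong (trans (*-comm d (a zero)) a₀d≈1) refl ⟨
        (d * a zero) * v i   ≈⟨ *-assoc _ _ _ ⟩
        d * (a zero * v i)   ≈⟨ *-cong refl (inverseˡ-unique _ _ (a·vu≈0 i)) ⟩
        d * - L i            ≈⟨ -‿distribʳ-* d (L i) ⟨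
        - (d * L i)          ≈⟨ -‿distribˡ-* d (L i) ⟩
        - d * L i            ∎

  data Suffix {k} (u : Fin k → V) : ∀ {t} → (Fin t → V) → Set c where
    here  : Suffix u u
    there : ∀ {t} {e : Fin t → V} x → Suffix u e → Suffix u (x ∷ e)

  suffix⇒⊆span : ∀ {k t} {u : Fin k → V} {e : Fin t → V} → Suffix u e → u ⊆span e
  suffix⇒⊆span here          = ∈span-member _
  suffix⇒⊆span (there x u≼e) = ∈span-tail (x ∷ _) ∘ suffix⇒⊆span u≼e

  extend-to-cover : ∀ {k m} {b : Fin m → V} (u : Fin k → V) → LinIndep u → u ⊆span b →
                    ∀ {r} (w : Fin r → V) → w ⊆span b →
                    Σ ℕ λ t → Σ (Fin t → V) λ e → Suffix u e × LinIndep e × e ⊆span b × w ⊆span e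
  extend-to-cover u u-indep u⊆b {zero} w w⊆b = _ , u , here , u-indep , u⊆b , λ ()
  extend-to-cover {b = b} u u-indep u⊆b {suc r} w w⊆b
    with t , e , u≼e , e-indep , e⊆b , tail-w⊆e ← extend-to-cover u u-indep u⊆b (tail w) (w⊆b ∘ suc)
    with w zero ∈span? e
  ... | yes w₀∈e = t , e , u≼e , e-indep , e⊆b , λ where
    zero    → w₀∈e
    (suc j) → tail-w⊆e j
  ... | no w₀∉e = suc t , w zero ∷ e , there (w zero) u≼e , independent-∷ e-indep w₀∉e , w₀e⊆b , w⊆w₀e
    where
    w₀e⊆b : (w zero ∷ e) ⊆span b
    w₀e⊆b zero    = w⊆b zero
    w₀e⊆b (suc i) = e⊆b i

    w⊆w₀e : w ⊆span (w zero ∷ e)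
    w⊆w₀e zero    = ∈span-member (w zero ∷ e) zero
    w⊆w₀e (suc j) = ∈span-tail (w zero ∷ e) (tail-w⊆e j)

  hyperplane-through : ∀ {n k} {b : Fin n → V} → LinIndep b →
                       (u : Fin k → V) → LinIndep u → u ⊆span b → k < n →
                       Σ ℕ λ t → suc t ≡ n × Σ (Subspace t) λ H′ →
                         Subspace.basis H′ ⊆span b × u ⊆span Subspace.basis H′
  hyperplane-through {b = b} b-indep u u-indep u⊆b k<n with extend-to-cover u u-indep u⊆b b (∈span-member b)
  ... | _ , _ , here , _ , _ , b⊆u = ⊥-elim (ℕ.<⇒≱ k<n (independent⊆span⇒≤ b-indep b⊆u))
  ... | _ , _ , there {t} {e} x u≼e , xe-indep , xe⊆b , b⊆xe =
    t , 1+t≡n , record { basis = e ; indep = independent-tail {e = x ∷ e} xe-indep } ,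
    xe⊆b ∘ suc , suffix⇒⊆span u≼e
    where
    1+t≡n : suc t ≡ _
    1+t≡n = ℕ.≤-antisym (independent⊆span⇒≤ {e = x ∷ e} xe-indep xe⊆b)
                        (independent⊆span⇒≤ {w = x ∷ e} b-indep b⊆xe)

module CuttingBlockingSet {c ℓ} {q} (F : FiniteField c ℓ q) (N : ℕ) where
  open Projective (FiniteField.field′ F) N
  open Span (FiniteField.field′ F) N
  open FiniteSpan F N
  open Subspace

  module _ {s} (S : V → Set s) where

    cutting⇒meetsAll : IsCuttingBlockingSet S → MeetsAllH S
    cutting⇒meetsAll cutting H n′ 1+n′≡N H′ _
      with j , bⱼ∉H′ ← ¬⊆span⇒∃∉span (λ b⊆H′ →
                         ℕ.<⇒≱ (ℕ.≤-reflexive 1+n′≡N) (independent⊆span⇒≤ (indep H) b⊆H′))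
      with _ , u , u⊆S∩H , bⱼ∈u ← cutting H (basis H j) (∈span-member (basis H) j)
      with i , uᵢ∉H′ ← ¬⊆span⇒∃∉span (λ u⊆H′ → bⱼ∉H′ (∈span-trans u⊆H′ bⱼ∈u))
      = u i , proj₁ (u⊆S∩H i) , proj₂ (u⊆S∩H i) , uᵢ∉H′

    module _ (meets : MeetsAllH S) (H : Hyperplane) where
      b : Fin N → V
      b = basis H

      point-outside-span : ∀ {k} (u : Fin k → V) → LinIndep u → u ⊆span b → k < N →
                  ∃ λ w → S w × w ∈span b × ¬ (w ∈span u)
      point-outside-span u u-indep u⊆H k<N
        with t , 1+t≡N , H′ , H′⊆H , u⊆H′ ← hyperplane-through (indep H) u u-indep u⊆H k<N
        with w , Sw , w∈H , w∉H′ ← meets H t 1+t≡N H′ (λ _ → ∈span-trans H′⊆H)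
        = w , Sw , w∈H , w∉H′ ∘ ∈span-trans u⊆H′

      independent-family : ∀ k → k ≤ N →
                           Σ (Fin k → V) λ u → LinIndep u × (∀ i → S (u i) × (u i ∈span b))
      independent-family zero    _   = (λ ()) , (λ _ _ ()) , λ ()
      independent-family (suc k) k<N
        with u , u-indep , u⊆S∩H ← independent-family k (ℕ.<⇒≤ k<N)
        with w , Sw , w∈H , w∉u ← point-outside-span u u-indep (proj₂ ∘ u⊆S∩H) k<N
        = w ∷ u , independent-∷ u-indep w∉u , λ where
          zero    → Sw , w∈H
          (suc i) → u⊆S∩H i

    meetsAll⇒cutting : MeetsAllH S → IsCuttingBlockingSet S
    meetsAll⇒cutting meets H v v∈H
      with u , u-indep , u⊆S∩H ← independent-family meets H N ℕ.≤-refl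
      with v ∈span? u
    ... | yes v∈u = N , u , u⊆S∩H , v∈u
    ... | no  v∉u = ⊥-elim (ℕ.1+n≰n (independent⊆span⇒≤ (independent-∷ u-indep v∉u) vu⊆H))
      where
      vu⊆H : (v ∷ u) ⊆span basis H
      vu⊆H zero    = v∈H
      vu⊆H (suc i) = proj₂ (u⊆S∩H i)

proposition3p5 : ∀ {c ℓ s : Level} (q N : ℕ) (F : FiniteField c ℓ q) →
    let open Projective (FiniteField.field′ F) N in
    (S : V → Set s) → IsPointSet S →
    (IsCuttingBlockingSet S → MeetsAllH S) × (MeetsAllH S → IsCuttingBlockingSet S)
proposition3p5 q N F S _ = CuttingBlockingSet.cutting⇒meetsAll F N S , CuttingBlockingSet.meetsAll⇒cutting F N S
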